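{- Let $k\in\mathbb{Z}_{\geq 0}$ and consider the equation \[X^2+Y^2+Z^2+2XY+kYZ+2ZX=(7+k)XYZ. \qquad (\ddagger)\] Every positive integer solution of $(\ddagger)$ appears exactly once as a vertex of the tree $\mathbb{T}^{2,k,2}$. Moreover, for every positive integer solution $(A,B,C)$ of $(\ddagger)$ there exist positive integers $b,c$ with $b^2=B$ and $c^2=C$.
   Context: For $k_1,k_2,k_3\in\mathbb{Z}_{\geq0}$, the tree $\mathbb{T}^{k_1,k_2,k_3}$ has triplets of positive integers as vertices and is built as follows. (1) The root vertex is $(1,1,1)$. (2) The root has exactly three children: $(k_2+2,1,1)$, $(1,k_3+2,1)$, $(1,1,k_1+2)$. (3) Every vertex $(a,b,c)$ other than the root has exactly two children: (i) if $a$ is the maximal number in $(a,b,c)$, the children are $\left(a,\frac{a^2+k_3ac+c^2}{b},c\right)$ and $\left(a,b,\frac{a^2+k_1ab+b^2}{c}\right)$; (ii) if $b$ is maximal, the children are $\left(\frac{b^2+k_2bc+c^2}{a},b,c\right)$ and $\left(a,b,\frac{a^2+k_1ab+b^2}{c}\right)$; (iii) if $c$ is maximal, the children are $\left(\frac{b^2+k_2bc+c^2}{a},b,c\right)$ and $\left(a,\frac{a^2+k_3ac+c^2}{b},c\right)$. Here $\mathbb{T}^{2,k,2}$ is this tree with $k_1=2$, $k_2=k$, $k_3=2$. -}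

module Defs where

open import Data.Nat using (ℕ; zero; suc; _+_; _*_; _≤ᵇ_)
open import Data.Nat.DivMod using (_/_)
open import Data.Bool using (Bool; true; false; if_then_else_; _∧_)
open import Data.Fin using (Fin; zero; suc)
open import Data.List using (List; foldl)
open import Data.Product using (_×_; _,_)

Triple : Set
Triple = ℕ × ℕ × ℕ

-- Division of naturals; only ever used where the division is exact
-- (denominators are positive entries of vertices). Returns 0 on a zero divisor.
divℕ : ℕ → ℕ → ℕ
divℕ a zero    = 0
divℕ a (suc b) = a / suc b

mutA : ℕ → Triple → Triple
mutA k₂ (a , b , c) = (divℕ (b * b + k₂ * b * c + c * c) a , b , c)

mutB : ℕ → Triple → Triple
mutB k₃ (a , b , c) = (a , divℕ (a * a + k₃ * a * c + c * c) b , c)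

mutC : ℕ → Triple → Triple
mutC k₁ (a , b , c) = (a , b , divℕ (a * a + k₁ * a * b + b * b) c)

-- Child of a non-root vertex: the Bool selects the first (false) or
-- second (true) child as listed in rule (3). "a is maximal" is tested
-- first, then "b is maximal", otherwise c is maximal.
step : ℕ → ℕ → ℕ → Triple → Bool → Triple
step k₁ k₂ k₃ t@(a , b , c) second =
  if (b ≤ᵇ a) ∧ (c ≤ᵇ a)
    then (if second then mutC k₁ t else mutB k₃ t)
    else (if c ≤ᵇ b
      then (if second then mutC k₁ t else mutA k₂ t)
      else (if second then mutB k₃ t else mutA k₂ t))

-- Vertices of the tree 𝕋^{k₁,k₂,k₃}: the root, or a path starting with
-- one of the three children of the root followed by a finite sequence of
-- binary choices.
data Vertex : Set where
  root : Vertex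
  node : Fin 3 → List Bool → Vertex

rootChild : ℕ → ℕ → ℕ → Fin 3 → Triple
rootChild k₁ k₂ k₃ zero             = (k₂ + 2 , 1 , 1)
rootChild k₁ k₂ k₃ (suc zero)       = (1 , k₃ + 2 , 1)
rootChild k₁ k₂ k₃ (suc (suc zero)) = (1 , 1 , k₁ + 2)

label : ℕ → ℕ → ℕ → Vertex → Triple
label k₁ k₂ k₃ root        = (1 , 1 , 1)
label k₁ k₂ k₃ (node i bs) = foldl (step k₁ k₂ k₃) (rootChild k₁ k₂ k₃ i) bs

Eqn : ℕ → ℕ → ℕ → ℕ → Set
Eqn k X Y Z =
  X * X + Y * Y + Z * Z + 2 * X * Y + k * Y * Z + 2 * Z * X ≡ (7 + k) * X * Y * Z
  where open import Relation.Binary.PropositionalEquality using (_≡_)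

{-# OPTIONS --safe #-}
-- Every coordinate enters X² + Y² + Z² + k₁XY + k₂YZ + k₃ZX = (3 + k₁ + k₂ + k₃)XYZ quadratically,
-- so replacing it by the other root of that quadratic (Vieta) is an involution on positive
-- solutions; these mutations are the edges of 𝕋^{k₁,k₂,k₃}. Mutating a coordinate below the
-- maximum makes it the new strict maximum, because the product of the two roots is at least the
-- square of the maximum. At a solution other than (1,1,1) the maximum is strict and mutating it
-- decreases it: were both roots at least the larger remaining coordinate z, the quadratic would be
-- nonnegative at z, which forces the remaining coordinates to be 1 and then the solution to be
-- (1,1,1). So descending along the maxima reaches (1,1,1), making every solution a label, and
-- labels are distinct because the parent of a vertex is its mutation at the strict maximum.
-- For k₁ = k₃ = 2 the products of the roots in the second and third coordinates are (a+c)² and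
-- (a+b)², so by a gcd argument these coordinates remain squares all along the tree.
module Submission where

open import Defs
open import Data.Nat using (ℕ; _≤_; _*_)
open import Data.Product using (_×_; _,_; ∃; ∃!)
open import Relation.Binary.PropositionalEquality using (_≡_)

open import Data.Bool using (Bool; true; false)
open import Data.Bool.Properties using (∧-zeroʳ)
open import Data.Empty using (⊥-elim)
open import Data.Fin using (Fin; zero; suc; punchIn; punchOut)
open import Data.Fin.Properties using (punchIn-injective; punchInᵢ≢i; punchIn-punchOut; 2↔Bool)
open import Data.List using (List; []; _∷_; reverse; foldl; _∷ʳ_)
open import Data.List.Properties using (unfold-reverse; foldl-∷ʳ; reverse-involutive; reverse-injective)
open import Data.Nat using (zero; suc; _+_; _<_; _≤ᵇ_; z≤n; s≤s; NonZero; >-nonZero; ≢-nonZero)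
open import Data.Nat.Coprimality using (coprime-/gcd; coprime-divisor)
open import Data.Nat.Divisibility using (divides; ∣-refl)
open import Data.Nat.DivMod using (_/_; m*n/n≡m; m/n*n≡m; n/1≡n)
open import Data.Nat.GCD using (gcd; gcd[m,n]∣m; gcd[m,n]∣n; gcd[m,n]≢0)
open import Data.Nat.Induction using (<-wellFounded)
open import Data.Nat.Properties
open import Data.Nat.Tactic.RingSolver using (solve)
open import Data.Product using (proj₁; proj₂; ∃₂)
open import Data.Sum using (_⊎_; inj₁; inj₂)
import Data.Sum as Sum
open import Function.Bundles using (_⇔_; mk⇔; Inverse; Equivalence)
open import Induction.WellFounded using (Acc; acc)
import Relation.Binary.Construct.On as On
open import Relation.Binary.PropositionalEquality
  using (refl; sym; trans; cong; cong₂; subst; subst₂; _≢_; module ≡-Reasoning)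
open import Relation.Nullary using (¬_; yes; no)
open import Relation.Nullary.Reflects using (ofʸ; ofⁿ; det)

divℕ-cancelʳ : ∀ y {x} → 1 ≤ x → divℕ (y * x) x ≡ y
divℕ-cancelʳ y {suc x} _ = m*n/n≡m y (suc x)

1≤m*n⇒1≤n : ∀ m {n} → 1 ≤ m * n → 1 ≤ n
1≤m*n⇒1≤n m {zero} 1≤m*0 = subst (1 ≤_) (*-zeroʳ m) 1≤m*0
1≤m*n⇒1≤n m {suc n} _ = s≤s z≤n

m+n≤m*n : ∀ {m n} → 2 ≤ m → 2 ≤ n → m + n ≤ m * n
m+n≤m*n (s≤s (s≤s {n = m} _)) (s≤s (s≤s {n = n} _)) = begin
  suc (suc m) + suc (suc n)                         ≤⟨ m≤m+n _ (m + n + m * n) ⟩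
  suc (suc m) + suc (suc n) + (m + n + m * n)       ≡⟨ solve (m ∷ n ∷ []) ⟩
  suc (suc m) * suc (suc n)                         ∎
  where open ≤-Reasoning

square≤*⇒< : ∀ {x m y} → x < m → m * m ≤ x * y → m < y
square≤*⇒< {x} {m} {y} x<m m*m≤x*y with m <? y
... | yes m<y = m<y
... | no m≮y = ⊥-elim (<-irrefl refl (begin-strict
  x * y ≤⟨ *-monoʳ-≤ x (≮⇒≥ m≮y) ⟩
  x * m <⟨ *-monoˡ-< m ⦃ >-nonZero (≤-<-trans z≤n x<m) ⦄ x<m ⟩
  m * m ≤⟨ m*m≤x*y ⟩
  x * y ∎))
  where open ≤-Reasoning

z*y+z*y′≤y*y′+z*z : ∀ {z y y′} → z ≤ y → z ≤ y′ → z * y + z * y′ ≤ y * y′ + z * z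
z*y+z*y′≤y*y′+z*z {z} z≤y z≤y′ with m≤n⇒∃[o]m+o≡n z≤y | m≤n⇒∃[o]m+o≡n z≤y′
... | d , refl | e , refl = begin
  z * (z + d) + z * (z + e)          ≤⟨ m≤m+n _ (d * e) ⟩
  z * (z + d) + z * (z + e) + d * e  ≡⟨ solve (z ∷ d ∷ e ∷ []) ⟩
  (z + d) * (z + e) + z * z          ∎
  where open ≤-Reasoning

px²+qxy+y²<[p+q+1]x²y : ∀ p q {x y} → 2 ≤ x → 1 ≤ y → y ≤ x →
                         p * x * x + q * x * y + y * y < (p + q + 1) * x * x * y
px²+qxy+y²<[p+q+1]x²y p q {x} {y} 2≤x 1≤y y≤x = begin-strict
  p * x * x + q * x * y + y * y
    <⟨ +-mono-≤-< (+-mono-≤ (m≤m*n (p * x * x) y) (*-monoˡ-≤ y (m≤m*n (q * x) x))) y*y<x*x*y ⟩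
  p * x * x * y + q * x * x * y + x * x * y
    ≡⟨ solve (p ∷ q ∷ x ∷ y ∷ []) ⟩
  (p + q + 1) * x * x * y ∎
  where
  open ≤-Reasoning
  instance
    _ : NonZero x
    _ = >-nonZero (≤-trans (s≤s z≤n) 2≤x)
    _ : NonZero y
    _ = >-nonZero 1≤y
  x<x*x : x < x * x
  x<x*x = subst (_< x * x) (*-identityʳ x) (*-monoʳ-< x 2≤x)
  y*y<x*x*y : y * y < x * x * y
  y*y<x*x*y = ≤-<-trans (*-monoˡ-≤ y y≤x) (*-monoˡ-< y x<x*x)

[p+q+1]x²y≤px²+qxy+y²⇒x≡1 : ∀ p q {x y} → (p + q + 1) * x * x * y ≤ p * x * x + q * x * y + y * y →
                            1 ≤ y → y ≤ x → x ≡ 1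
[p+q+1]x²y≤px²+qxy+y²⇒x≡1 p q {zero} _ 1≤y y≤0 = ⊥-elim (<-irrefl refl (≤-trans 1≤y y≤0))
[p+q+1]x²y≤px²+qxy+y²⇒x≡1 p q {suc zero} _ _ _ = refl
[p+q+1]x²y≤px²+qxy+y²⇒x≡1 p q {suc (suc x)} cubic≤quadratic 1≤y y≤x =
  ⊥-elim (<-irrefl refl (<-≤-trans (px²+qxy+y²<[p+q+1]x²y p q (s≤s (s≤s z≤n)) 1≤y y≤x) cubic≤quadratic))

x+L≤S : ∀ {x L Q S} → 1 ≤ x → x * x + x * L + Q ≡ x * S → x + L ≤ S
x+L≤S {x} {L} {Q} {S} 1≤x x-root = *-cancelˡ-≤ x ⦃ >-nonZero 1≤x ⦄ (begin
  x * (x + L)       ≡⟨ *-distribˡ-+ x x L ⟩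
  x * x + x * L     ≤⟨ m≤m+n _ Q ⟩
  x * x + x * L + Q ≡⟨ x-root ⟩
  x * S             ∎)
  where open ≤-Reasoning

Q≡x′*x : ∀ {x L Q x′} → x * x + x * L + Q ≡ x * (x + L + x′) → Q ≡ x′ * x
Q≡x′*x {x} {L} {Q} {x′} x-root = +-cancelˡ-≡ (x * x + x * L) Q (x′ * x) (trans x-root expand)
  where
  expand : x * (x + L + x′) ≡ x * x + x * L + x′ * x
  expand = solve (x ∷ L ∷ x′ ∷ [])

vieta : ∀ {x L Q S} → 1 ≤ x → x * x + x * L + Q ≡ x * S →
        x * divℕ Q x ≡ Q × x + divℕ Q x + L ≡ S
vieta {x} {L} {Q} 1≤x x-root with m≤n⇒∃[o]m+o≡n (x+L≤S 1≤x x-root)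
... | x′ , refl with Q≡x′*x {x} {L} {Q} {x′} x-root
... | refl = subst (λ y → x * y ≡ x′ * x × x + y + L ≡ x + L + x′) (sym (divℕ-cancelʳ x′ 1≤x))
                   (*-comm x x′ , solve (x ∷ x′ ∷ L ∷ []))

vieta-root : ∀ {x x′ L Q S} → x * x′ ≡ Q → x + x′ + L ≡ S → x′ * x′ + x′ * L + Q ≡ x′ * S
vieta-root {x} {x′} {L} refl refl = solve (x ∷ x′ ∷ L ∷ [])

form : ℕ → ℕ → ℕ → ℕ
form γ u v = u * u + γ * u * v + v * v

form-comm : ∀ γ u v → form γ u v ≡ form γ v u
form-comm γ u v = expanded
  where
  expanded : u * u + γ * u * v + v * v ≡ v * v + γ * v * u + u * u
  expanded = solve (γ ∷ u ∷ v ∷ [])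

-- x solves x² + u² + v² + αxu + βxv + γuv = (3 + α + β + γ)xuv, read as a quadratic in x
IsRoot : (α β γ u v x : ℕ) → Set
IsRoot α β γ u v x = x * x + x * (α * u + β * v) + form γ u v ≡ x * ((3 + α + β + γ) * u * v)

isRoot-swap : ∀ {α β γ u v x} → IsRoot α β γ u v x → IsRoot β α γ v u x
isRoot-swap {α} {β} {γ} {u} {v} {x} x-root = begin
  x * x + x * (β * v + α * u) + form γ v u
    ≡⟨ cong₂ (λ l q → x * x + x * l + q) (+-comm (β * v) (α * u)) (form-comm γ v u) ⟩
  x * x + x * (α * u + β * v) + form γ u v        ≡⟨ x-root ⟩
  x * ((3 + α + β + γ) * u * v)                   ≡⟨ solve (α ∷ β ∷ γ ∷ u ∷ v ∷ x ∷ []) ⟩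
  x * ((3 + β + α + γ) * v * u)                   ∎
  where open ≡-Reasoning

form-one : ∀ γ → form γ 1 1 ≡ γ + 2
form-one γ = expanded
  where
  expanded : 1 * 1 + γ * 1 * 1 + 1 * 1 ≡ γ + 2
  expanded = solve (γ ∷ [])

form-two : ∀ u v → form 2 u v ≡ (u + v) * (u + v)
form-two u v = expanded
  where
  expanded : u * u + 2 * u * v + v * v ≡ (u + v) * (u + v)
  expanded = solve (u ∷ v ∷ [])

u*u≤form : ∀ γ u v → u * u ≤ form γ u v
u*u≤form γ u v = ≤-trans (m≤m+n (u * u) (γ * u * v)) (m≤m+n _ (v * v))

v*v≤form : ∀ γ u v → v * v ≤ form γ u v
v*v≤form γ u v = m≤n+m (v * v) _

form-exceedsˡ : ∀ γ {u v x y} → x * y ≡ form γ u v → x < u → v ≤ u → u < y × v < y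
form-exceedsˡ γ {u} {v} {y = y} xy≡form x<u v≤u = u<y , ≤-<-trans v≤u u<y
  where
  u<y : u < y
  u<y = square≤*⇒< x<u (subst (u * u ≤_) (sym xy≡form) (u*u≤form γ u v))

form-exceedsʳ : ∀ γ {u v x y} → x * y ≡ form γ u v → x < v → u ≤ v → u < y × v < y
form-exceedsʳ γ {u} {v} {y = y} xy≡form x<v u≤v = ≤-<-trans u≤v v<y , v<y
  where
  v<y : v < y
  v<y = square≤*⇒< x<v (subst (v * v ≤_) (sym xy≡form) (v*v≤form γ u v))

-- The quadratic z² + Lz + Q − Sz is nonnegative at z when z lies below both roots or is a root.
≤-roots⇒bound : ∀ {z x y L Q S} → z ≤ x → z ≤ y → x * y ≡ Q → x + y + L ≡ S →
                z * S ≤ Q + z * z + z * L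
≤-roots⇒bound {z} {x} {y} {L} z≤x z≤y refl refl = begin
  z * (x + y + L)       ≡⟨ solve (z ∷ x ∷ y ∷ L ∷ []) ⟩
  z * x + z * y + z * L ≤⟨ +-monoˡ-≤ (z * L) (z*y+z*y′≤y*y′+z*z z≤x z≤y) ⟩
  x * y + z * z + z * L ∎
  where open ≤-Reasoning

root⇒bound : ∀ {z L Q S} → z * z + z * L + Q ≡ z * S → z * S ≤ Q + z * z + z * L
root⇒bound {z} {L} {Q} z-root = ≤-reflexive (trans (sym z-root) (solve (z ∷ L ∷ Q ∷ [])))

root-bound⇒ones : ∀ {α β γ u v} → 1 ≤ v → v ≤ u →
                  u * ((3 + α + β + γ) * u * v) ≤ form γ u v + u * u + u * (α * u + β * v) →
                  u ≡ 1 × v ≡ 1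
root-bound⇒ones {α} {β} {γ} {u} {v} 1≤v v≤u bound = u≡1 , ≤-antisym (subst (v ≤_) u≡1 v≤u) 1≤v
  where
  cubic : u * ((3 + α + β + γ) * u * v) ≡ (2 + α + (β + γ) + 1) * u * u * v
  cubic = solve (α ∷ β ∷ γ ∷ u ∷ v ∷ [])
  quadratic : u * u + γ * u * v + v * v + u * u + u * (α * u + β * v) ≡
              (2 + α) * u * u + (β + γ) * u * v + v * v
  quadratic = solve (α ∷ β ∷ γ ∷ u ∷ v ∷ [])
  u≡1 : u ≡ 1
  u≡1 = [p+q+1]x²y≤px²+qxy+y²⇒x≡1 (2 + α) (β + γ) (subst₂ _≤_ cubic quadratic bound) 1≤v v≤u

unit-roots : ∀ {α β γ x y} → x * y ≡ form γ 1 1 →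
             x + y + (α * 1 + β * 1) ≡ (3 + α + β + γ) * 1 * 1 → x * y + 1 ≡ x + y
unit-roots {α} {β} {γ} {x} {y} prod sum = +-cancelʳ-≡ (α * 1 + β * 1) (x * y + 1) (x + y) (begin
  x * y + 1 + (α * 1 + β * 1)                      ≡⟨ cong (λ q → q + 1 + (α * 1 + β * 1)) prod ⟩
  1 * 1 + γ * 1 * 1 + 1 * 1 + 1 + (α * 1 + β * 1) ≡⟨ solve (α ∷ β ∷ γ ∷ []) ⟩
  (3 + α + β + γ) * 1 * 1                          ≡⟨ sum ⟨
  x + y + (α * 1 + β * 1)                          ∎)
  where open ≡-Reasoning

roots-above-max : ∀ {α β γ u v x} → 1 ≤ v → v ≤ u → u < x → IsRoot α β γ u v x →
                  ¬ x ≤ divℕ (form γ u v) x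
roots-above-max {α} {β} {γ} {u} {v} {x} 1≤v v≤u u<x x-root x≤x′
  with vieta (≤-trans (≤-trans 1≤v v≤u) (<⇒≤ u<x)) x-root
... | prod , sum
  with root-bound⇒ones {α} {β} {γ} 1≤v v≤u (≤-roots⇒bound (<⇒≤ u<x) (≤-trans (<⇒≤ u<x) x≤x′) prod sum)
... | refl , refl = <-irrefl (sym (unit-roots {α} {β} {γ} {x} prod sum))
                              (≤-<-trans (m+n≤m*n u<x (<-≤-trans u<x x≤x′)) (m<m+n _ (s≤s z≤n)))

descent-ordered : ∀ {α β γ u v x} → 1 ≤ v → v ≤ u → u ≤ x → IsRoot α β γ u v x →
                  (x ≡ 1 × u ≡ 1 × v ≡ 1) ⊎ (u < x × divℕ (form γ u v) x < x)
descent-ordered {α} {β} {γ} {u} {v} {x} 1≤v v≤u u≤x x-root with m≤n⇒m<n∨m≡n u≤x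
... | inj₂ refl = inj₁ (proj₁ ones , ones)
  where
  ones : u ≡ 1 × v ≡ 1
  ones = root-bound⇒ones {α} {β} {γ} 1≤v v≤u (root⇒bound {u} {α * u + β * v} x-root)
... | inj₁ u<x with divℕ (form γ u v) x <? x
...   | yes x′<x = inj₂ (u<x , x′<x)
...   | no x′≮x = ⊥-elim (roots-above-max {α} {β} {γ} 1≤v v≤u u<x x-root (≮⇒≥ x′≮x))

descent : ∀ {α β γ u v x} → 1 ≤ u → 1 ≤ v → u ≤ x → v ≤ x → IsRoot α β γ u v x →
          (x ≡ 1 × u ≡ 1 × v ≡ 1) ⊎ (u < x × v < x × divℕ (form γ u v) x < x)
descent {α} {β} {γ} {u} {v} {x} 1≤u 1≤v u≤x v≤x x-root with ≤-total v u
... | inj₁ v≤u with descent-ordered {α} {β} {γ} 1≤v v≤u u≤x x-root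
...   | inj₁ ones = inj₁ ones
...   | inj₂ (u<x , x′<x) = inj₂ (u<x , ≤-<-trans v≤u u<x , x′<x)
descent {α} {β} {γ} {u} {v} {x} 1≤u 1≤v u≤x v≤x x-root | inj₂ u≤v
  with descent-ordered {β} {α} {γ} 1≤u u≤v v≤x (isRoot-swap {α} {β} {γ} {u} {v} {x} x-root)
...   | inj₁ (x≡1 , v≡1 , u≡1) = inj₁ (x≡1 , u≡1 , v≡1)
...   | inj₂ (v<x , x′<x) =
  inj₂ (≤-<-trans u≤v v<x , v<x , subst (λ q → divℕ q x < x) (form-comm γ v u) x′<x)

IsSquare : ℕ → Set
IsSquare n = ∃ λ r → r * r ≡ n

-- With g = gcd β μ, p = β / g and q = μ / g are coprime and p²n = q², so p ∣ q and p = 1.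
isSquare-cancelˡ : ∀ {m n} → 1 ≤ m → IsSquare m → IsSquare (m * n) → IsSquare n
isSquare-cancelˡ {n = n} 1≤m (β@(suc _) , refl) (μ , μμ≡ββn) = q , sym n≡q*q
  where
  g p q : ℕ
  g = gcd β μ
  instance
    _ : NonZero g
    _ = ≢-nonZero (gcd[m,n]≢0 β μ (inj₁ λ ()))
    _ : NonZero (g * g)
    _ = m*n≢0 g g
  p = β / g
  q = μ / g
  p*[p*n]≡q*q : p * (p * n) ≡ q * q
  p*[p*n]≡q*q = *-cancelˡ-≡ (p * (p * n)) (q * q) (g * g) (begin
    g * g * (p * (p * n)) ≡⟨ regroup g p n ⟩
    p * g * (p * g) * n   ≡⟨ cong (λ b → b * b * n) (m/n*n≡m (gcd[m,n]∣m β μ)) ⟩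
    β * β * n             ≡⟨ μμ≡ββn ⟨
    μ * μ                 ≡⟨ cong (λ m → m * m) (m/n*n≡m (gcd[m,n]∣n β μ)) ⟨
    q * g * (q * g)       ≡⟨ regroup′ g q ⟩
    g * g * (q * q)       ∎)
    where
    open ≡-Reasoning
    regroup : ∀ g p n → g * g * (p * (p * n)) ≡ p * g * (p * g) * n
    regroup g p n = solve (g ∷ p ∷ n ∷ [])
    regroup′ : ∀ g q → q * g * (q * g) ≡ g * g * (q * q)
    regroup′ g q = solve (g ∷ q ∷ [])
  p≡1 : p ≡ 1
  p≡1 = coprime-/gcd β μ (∣-refl , coprime-divisor (coprime-/gcd β μ)
          (divides (p * n) (trans (sym p*[p*n]≡q*q) (*-comm p (p * n)))))
  n≡q*q : n ≡ q * q
  n≡q*q = begin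
    n           ≡⟨ solve (n ∷ []) ⟩
    1 * (1 * n) ≡⟨ cong (λ r → r * (r * n)) p≡1 ⟨
    p * (p * n) ≡⟨ p*[p*n]≡q*q ⟩
    q * q       ∎
    where open ≡-Reasoning

Coord : Set
Coord = Fin 3

pattern X = zero
pattern Y = suc zero
pattern Z = suc (suc zero)

_!_ : Triple → Coord → ℕ
(a , b , c) ! X = a
(a , b , c) ! Y = b
(a , b , c) ! Z = c

others : Coord → Triple → ℕ × ℕ
others X (a , b , c) = b , c
others Y (a , b , c) = a , c
others Z (a , b , c) = a , b

replace : Coord → ℕ → Triple → Triple
replace X x (a , b , c) = x , b , c
replace Y x (a , b , c) = a , x , c
replace Z x (a , b , c) = a , b , x

replace-! : ∀ d x t → replace d x t ! d ≡ x
replace-! X x t = refl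
replace-! Y x t = refl
replace-! Z x t = refl

replace-self : ∀ d t → replace d (t ! d) t ≡ t
replace-self X t = refl
replace-self Y t = refl
replace-self Z t = refl

≡-cong⇔ : ∀ {a a′ b b′ : ℕ} → a ≡ a′ → b ≡ b′ → (a ≡ b) ⇔ (a′ ≡ b′)
≡-cong⇔ refl refl = mk⇔ (λ e → e) (λ e → e)

one : Triple
one = 1 , 1 , 1

one-split : ∀ d {t} → t ! d ≡ 1 → proj₁ (others d t) ≡ 1 → proj₂ (others d t) ≡ 1 → t ≡ one
one-split X refl refl refl = refl
one-split Y refl refl refl = refl
one-split Z refl refl refl = refl

size : Triple → ℕ
size (a , b , c) = a + b + c

size-replace : ∀ d {y t} → y < t ! d → size (replace d y t) < size t
size-replace X {t = _ , b , c} y<a = +-monoˡ-< c (+-monoˡ-< b y<a)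
size-replace Y {t = a , _ , c} y<b = +-monoˡ-< c (+-monoʳ-< a y<b)
size-replace Z {t = a , b , _} y<c = +-monoʳ-< (a + b) y<c

Positive : Triple → Set
Positive (a , b , c) = 1 ≤ a × 1 ≤ b × 1 ≤ c

positive-split : ∀ d {t} → Positive t → 1 ≤ t ! d × 1 ≤ proj₁ (others d t) × 1 ≤ proj₂ (others d t)
positive-split X (pa , pb , pc) = pa , pb , pc
positive-split Y (pa , pb , pc) = pb , pa , pc
positive-split Z (pa , pb , pc) = pc , pa , pb

positive-replace : ∀ d {y t} → Positive t → 1 ≤ y → Positive (replace d y t)
positive-replace X (_ , pb , pc) py = py , pb , pc
positive-replace Y (pa , _ , pc) py = pa , py , pc
positive-replace Z (pa , pb , _) py = pa , pb , py

IsMax IsStrictMax : Coord → Triple → Set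
IsMax d t = proj₁ (others d t) ≤ t ! d × proj₂ (others d t) ≤ t ! d
IsStrictMax d t = proj₁ (others d t) < t ! d × proj₂ (others d t) < t ! d

maximal : ∀ t → ∃ λ d → IsMax d t
maximal (a , b , c) with ≤-total b a | ≤-total c a | ≤-total c b
... | inj₁ b≤a | inj₁ c≤a | _        = X , b≤a , c≤a
... | inj₁ b≤a | inj₂ a≤c | _        = Z , a≤c , ≤-trans b≤a a≤c
... | inj₂ a≤b | _        | inj₁ c≤b = Y , a≤b , c≤b
... | inj₂ a≤b | _        | inj₂ b≤c = Z , ≤-trans a≤b b≤c , b≤c

strictMax⇒max : ∀ d {t} → IsStrictMax d t → IsMax d t
strictMax⇒max d (u<x , v<x) = <⇒≤ u<x , <⇒≤ v<x

¬strictMax-one : ∀ d → ¬ IsStrictMax d one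
¬strictMax-one X (1<1 , _) = <-irrefl refl 1<1
¬strictMax-one Y (1<1 , _) = <-irrefl refl 1<1
¬strictMax-one Z (1<1 , _) = <-irrefl refl 1<1

strictMax-unique : ∀ d e {t} → IsStrictMax d t → IsStrictMax e t → d ≡ e
strictMax-unique X X _ _ = refl
strictMax-unique Y Y _ _ = refl
strictMax-unique Z Z _ _ = refl
strictMax-unique X Y (b<a , _) (a<b , _) = ⊥-elim (<-asym b<a a<b)
strictMax-unique X Z (_ , c<a) (a<c , _) = ⊥-elim (<-asym c<a a<c)
strictMax-unique Y X (a<b , _) (b<a , _) = ⊥-elim (<-asym a<b b<a)
strictMax-unique Y Z (_ , c<b) (_ , b<c) = ⊥-elim (<-asym c<b b<c)
strictMax-unique Z X (a<c , _) (_ , c<a) = ⊥-elim (<-asym a<c c<a)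
strictMax-unique Z Y (_ , b<c) (_ , c<b) = ⊥-elim (<-asym b<c c<b)

-- The two coordinates other than d, in increasing order.
child : Coord → Bool → Coord
child d b = punchIn d (Inverse.from 2↔Bool b)

child≢ : ∀ d b → child d b ≢ d
child≢ d b = punchInᵢ≢i d _

child-injective : ∀ d {b b′} → child d b ≡ child d b′ → b ≡ b′
child-injective d {b} {b′} eq = begin
  b            ≡⟨ strictlyInverseˡ b ⟨
  to (from b)  ≡⟨ cong to (punchIn-injective d _ _ eq) ⟩
  to (from b′) ≡⟨ strictlyInverseˡ b′ ⟩
  b′           ∎
  where
  open ≡-Reasoning
  open Inverse 2↔Bool

child-surjective : ∀ {d e} → d ≢ e → ∃ λ b → child d b ≡ e
child-surjective {d} d≢e =
  Inverse.to 2↔Bool j , trans (cong (punchIn d) (Inverse.strictlyInverseʳ 2↔Bool j)) (punchIn-punchOut d≢e)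
  where
  j : Fin 2
  j = punchOut d≢e

≤ᵇ-true : ∀ {m n} → m ≤ n → (m ≤ᵇ n) ≡ true
≤ᵇ-true {m} {n} m≤n = det (≤ᵇ-reflects-≤ m n) (ofʸ m≤n)

≤ᵇ-false : ∀ {m n} → n < m → (m ≤ᵇ n) ≡ false
≤ᵇ-false {m} {n} n<m = det (≤ᵇ-reflects-≤ m n) (ofⁿ (<⇒≱ n<m))

module Tree (k₁ k₂ k₃ : ℕ) where

  Markov : Triple → Set
  Markov (a , b , c) =
    a * a + b * b + c * c + k₁ * a * b + k₂ * b * c + k₃ * c * a ≡ (3 + k₁ + k₂ + k₃) * a * b * c

  Solution : Triple → Set
  Solution t = Positive t × Markov t

  coefficients : Coord → ℕ × ℕ × ℕ
  coefficients X = k₁ , k₃ , k₂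
  coefficients Y = k₁ , k₂ , k₃
  coefficients Z = k₃ , k₂ , k₁

  Root : Coord → Triple → ℕ → Set
  Root d t x = let (α , β , γ) = coefficients d ; (u , v) = others d t in IsRoot α β γ u v x

  rootProduct : Coord → Triple → ℕ
  rootProduct d t = let (_ , _ , γ) = coefficients d ; (u , v) = others d t in form γ u v

  conjugate : Coord → Triple → ℕ
  conjugate d t = divℕ (rootProduct d t) (t ! d)

  mutate : Coord → Triple → Triple
  mutate d t = replace d (conjugate d t) t

  markov⇔root : ∀ d t x → Markov (replace d x t) ⇔ Root d t x
  markov⇔root X (_ , b , c) x = ≡-cong⇔ lhs rhs
    where
    lhs : x * x + b * b + c * c + k₁ * x * b + k₂ * b * c + k₃ * c * x ≡
          x * x + x * (k₁ * b + k₃ * c) + (b * b + k₂ * b * c + c * c)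
    lhs = solve (k₁ ∷ k₂ ∷ k₃ ∷ x ∷ b ∷ c ∷ [])
    rhs : (3 + k₁ + k₂ + k₃) * x * b * c ≡ x * ((3 + k₁ + k₃ + k₂) * b * c)
    rhs = solve (k₁ ∷ k₂ ∷ k₃ ∷ x ∷ b ∷ c ∷ [])
  markov⇔root Y (a , _ , c) x = ≡-cong⇔ lhs rhs
    where
    lhs : a * a + x * x + c * c + k₁ * a * x + k₂ * x * c + k₃ * c * a ≡
          x * x + x * (k₁ * a + k₂ * c) + (a * a + k₃ * a * c + c * c)
    lhs = solve (k₁ ∷ k₂ ∷ k₃ ∷ a ∷ x ∷ c ∷ [])
    rhs : (3 + k₁ + k₂ + k₃) * a * x * c ≡ x * ((3 + k₁ + k₂ + k₃) * a * c)
    rhs = solve (k₁ ∷ k₂ ∷ k₃ ∷ a ∷ x ∷ c ∷ [])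
  markov⇔root Z (a , b , _) x = ≡-cong⇔ lhs rhs
    where
    lhs : a * a + b * b + x * x + k₁ * a * b + k₂ * b * x + k₃ * x * a ≡
          x * x + x * (k₃ * a + k₂ * b) + (a * a + k₁ * a * b + b * b)
    lhs = solve (k₁ ∷ k₂ ∷ k₃ ∷ a ∷ b ∷ x ∷ [])
    rhs : (3 + k₁ + k₂ + k₃) * a * b * x ≡ x * ((3 + k₃ + k₂ + k₁) * a * b)
    rhs = solve (k₁ ∷ k₂ ∷ k₃ ∷ a ∷ b ∷ x ∷ [])

  markov⇒root : ∀ d {t} → Markov t → Root d t (t ! d)
  markov⇒root d {t} m = Equivalence.to (markov⇔root d t (t ! d)) (subst Markov (sym (replace-self d t)) m)

  conjugate-vieta : ∀ d {t} → Solution t →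
                    t ! d * conjugate d t ≡ rootProduct d t × Root d t (conjugate d t)
  conjugate-vieta d {t} (pos , m) =
    let (product , sum) = vieta (proj₁ (positive-split d pos)) (markov⇒root d m)
    in product , vieta-root {t ! d} product sum

  conjugate-product : ∀ d {t} → Solution t → t ! d * conjugate d t ≡ rootProduct d t
  conjugate-product d s = proj₁ (conjugate-vieta d s)

  conjugate-positive : ∀ d {t} → Solution t → 1 ≤ conjugate d t
  conjugate-positive d {t} s@(pos , _) =
    let (_ , _ , γ) = coefficients d ; (u , v) = others d t ; (_ , 1≤u , _) = positive-split d pos
        1≤rootProduct : 1 ≤ form γ u v
        1≤rootProduct = ≤-trans (*-mono-≤ 1≤u 1≤u) (u*u≤form γ u v)
    in 1≤m*n⇒1≤n (t ! d) (subst (1 ≤_) (sym (conjugate-product d s)) 1≤rootProduct)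

  mutate-solution : ∀ d {t} → Solution t → Solution (mutate d t)
  mutate-solution d {t} s@(pos , _) =
    positive-replace d pos (conjugate-positive d s) ,
    Equivalence.from (markov⇔root d t _) (proj₂ (conjugate-vieta d s))

  mutate-replace : ∀ d y t → mutate d (replace d y t) ≡ replace d (divℕ (rootProduct d t) y) t
  mutate-replace X y t = refl
  mutate-replace Y y t = refl
  mutate-replace Z y t = refl

  mutate-involutive : ∀ d {t} → Solution t → mutate d (mutate d t) ≡ t
  mutate-involutive d {t} s = begin
    mutate d (mutate d t)                                ≡⟨ mutate-replace d (conjugate d t) t ⟩
    replace d (divℕ (rootProduct d t) (conjugate d t)) t ≡⟨ cong (λ x → replace d x t) back ⟩
    replace d (t ! d) t                                  ≡⟨ replace-self d t ⟩
    t                                                    ∎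
    where
    open ≡-Reasoning
    back : divℕ (rootProduct d t) (conjugate d t) ≡ t ! d
    back = trans (cong (λ q → divℕ q (conjugate d t)) (sym (conjugate-product d s)))
                 (divℕ-cancelʳ (t ! d) (conjugate-positive d s))

  mutate-strictMax : ∀ d e {t} → Solution t → IsStrictMax e t → d ≢ e → IsStrictMax d (mutate d t)
  mutate-strictMax X X _ _               X≢X = ⊥-elim (X≢X refl)
  mutate-strictMax Y Y _ _               Y≢Y = ⊥-elim (Y≢Y refl)
  mutate-strictMax Z Z _ _               Z≢Z = ⊥-elim (Z≢Z refl)
  mutate-strictMax X Y s (a<b , c<b) _ = form-exceedsˡ k₂ (conjugate-product X s) a<b (<⇒≤ c<b)
  mutate-strictMax X Z s (a<c , b<c) _ = form-exceedsʳ k₂ (conjugate-product X s) a<c (<⇒≤ b<c)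
  mutate-strictMax Y X s (b<a , c<a) _ = form-exceedsˡ k₃ (conjugate-product Y s) b<a (<⇒≤ c<a)
  mutate-strictMax Y Z s (a<c , b<c) _ = form-exceedsʳ k₃ (conjugate-product Y s) b<c (<⇒≤ a<c)
  mutate-strictMax Z X s (b<a , c<a) _ = form-exceedsˡ k₁ (conjugate-product Z s) c<a (<⇒≤ b<a)
  mutate-strictMax Z Y s (a<b , c<b) _ = form-exceedsʳ k₁ (conjugate-product Z s) c<b (<⇒≤ a<b)

  descend : ∀ d {t} → Solution t → IsMax d t → t ≡ one ⊎ (IsStrictMax d t × conjugate d t < t ! d)
  descend d (pos , m) (u≤x , v≤x) =
    let (α , β , γ) = coefficients d ; (_ , 1≤u , 1≤v) = positive-split d pos
    in Sum.map (λ (x≡1 , u≡1 , v≡1) → one-split d x≡1 u≡1 v≡1)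
               (λ (u<x , v<x , x′<x) → (u<x , v<x) , x′<x)
               (descent {α} {β} {γ} 1≤u 1≤v u≤x v≤x (markov⇒root d m))

  strictMax-descends : ∀ d {t} → Solution t → IsStrictMax d t → conjugate d t < t ! d
  strictMax-descends d s max with descend d s (strictMax⇒max d max)
  ... | inj₁ refl = ⊥-elim (¬strictMax-one d max)
  ... | inj₂ (_ , x′<x) = x′<x

  mutate-loses-strictMax : ∀ d {t} → Solution t → IsStrictMax d t → ¬ IsStrictMax d (mutate d t)
  mutate-loses-strictMax d {t} s max max′ = <-asym (strictMax-descends d s max) (begin-strict
    t ! d                     ≡⟨ cong (_! d) (mutate-involutive d s) ⟨
    mutate d (mutate d t) ! d ≡⟨ replace-! d _ _ ⟩
    conjugate d (mutate d t)  <⟨ strictMax-descends d (mutate-solution d s) max′ ⟩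
    mutate d t ! d            ≡⟨ replace-! d _ _ ⟩
    conjugate d t             ∎)
    where open ≤-Reasoning

  step-child : ∀ d {t} → IsStrictMax d t → ∀ b → step k₁ k₂ k₃ t b ≡ mutate (child d b) t
  step-child X (b<a , c<a) false rewrite ≤ᵇ-true (<⇒≤ b<a) | ≤ᵇ-true (<⇒≤ c<a) = refl
  step-child X (b<a , c<a) true  rewrite ≤ᵇ-true (<⇒≤ b<a) | ≤ᵇ-true (<⇒≤ c<a) = refl
  step-child Y (a<b , c<b) false rewrite ≤ᵇ-false a<b | ≤ᵇ-true (<⇒≤ c<b) = refl
  step-child Y (a<b , c<b) true  rewrite ≤ᵇ-false a<b | ≤ᵇ-true (<⇒≤ c<b) = refl
  step-child Z {a , b , _} (a<c , b<c) false
    rewrite ≤ᵇ-false a<c | ∧-zeroʳ (b ≤ᵇ a) | ≤ᵇ-false b<c = refl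
  step-child Z {a , b , _} (a<c , b<c) true
    rewrite ≤ᵇ-false a<c | ∧-zeroʳ (b ≤ᵇ a) | ≤ᵇ-false b<c = refl

  one-solution : Solution one
  one-solution = (s≤s z≤n , s≤s z≤n , s≤s z≤n) , markov-one
    where
    markov-one : 1 * 1 + 1 * 1 + 1 * 1 + k₁ * 1 * 1 + k₂ * 1 * 1 + k₃ * 1 * 1 ≡
                 (3 + k₁ + k₂ + k₃) * 1 * 1 * 1
    markov-one = solve (k₁ ∷ k₂ ∷ k₃ ∷ [])

  rootChild≡mutate : ∀ d → rootChild k₁ k₂ k₃ d ≡ mutate d one
  rootChild≡mutate X = cong (λ x → x , 1 , 1) (sym (trans (n/1≡n _) (form-one k₂)))
  rootChild≡mutate Y = cong (λ x → 1 , x , 1) (sym (trans (n/1≡n _) (form-one k₃)))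
  rootChild≡mutate Z = cong (λ x → 1 , 1 , x) (sym (trans (n/1≡n _) (form-one k₁)))

  rootChild-strictMax : ∀ d → IsStrictMax d (rootChild k₁ k₂ k₃ d)
  rootChild-strictMax X = m≤n+m 2 k₂ , m≤n+m 2 k₂
  rootChild-strictMax Y = m≤n+m 2 k₃ , m≤n+m 2 k₃
  rootChild-strictMax Z = m≤n+m 2 k₁ , m≤n+m 2 k₁

  -- walk i bs is the label of node i (reverse bs): the head of bs is the last step.
  walk : Fin 3 → List Bool → Triple
  walk i []       = rootChild k₁ k₂ k₃ i
  walk i (b ∷ bs) = step k₁ k₂ k₃ (walk i bs) b

  peak : Fin 3 → List Bool → Coord
  peak i []       = i
  peak i (b ∷ bs) = child (peak i bs) b

  parent : Fin 3 → List Bool → Triple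
  parent i []       = one
  parent i (b ∷ bs) = walk i bs

  walk-invariant : ∀ i bs → Solution (walk i bs) × IsStrictMax (peak i bs) (walk i bs)
  walk-invariant i [] =
    subst Solution (sym (rootChild≡mutate i)) (mutate-solution i one-solution) , rootChild-strictMax i
  walk-invariant i (b ∷ bs) with walk-invariant i bs
  ... | s , max rewrite step-child (peak i bs) max b =
    mutate-solution (child (peak i bs) b) s , mutate-strictMax _ (peak i bs) s max (child≢ (peak i bs) b)

  walk-mutate : ∀ i bs → walk i bs ≡ mutate (peak i bs) (parent i bs)
  walk-mutate i []       = rootChild≡mutate i
  walk-mutate i (b ∷ bs) = step-child (peak i bs) (proj₂ (walk-invariant i bs)) b

  parent-solution : ∀ i bs → Solution (parent i bs)
  parent-solution i []       = one-solution
  parent-solution i (_ ∷ bs) = proj₁ (walk-invariant i bs)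

  walk≢one : ∀ {i} bs → walk i bs ≢ one
  walk≢one {i} bs eq =
    ¬strictMax-one (peak i bs) (subst (IsStrictMax (peak i bs)) eq (proj₂ (walk-invariant i bs)))

  mutate-cancel : ∀ {d e s t} → Solution s → Solution t →
                  IsStrictMax d (mutate d s) → IsStrictMax e (mutate e t) →
                  mutate d s ≡ mutate e t → d ≡ e × s ≡ t
  mutate-cancel {d} {e} {s} {t} sol-s sol-t max-s max-t eq
    with strictMax-unique d e (subst (IsStrictMax d) eq max-s) max-t
  ... | refl = refl , (begin
    s                     ≡⟨ mutate-involutive d sol-s ⟨
    mutate d (mutate d s) ≡⟨ cong (mutate d) eq ⟩
    mutate d (mutate d t) ≡⟨ mutate-involutive d sol-t ⟩
    t                     ∎)
    where open ≡-Reasoning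

  walk-injective : ∀ {i j} bs cs → walk i bs ≡ walk j cs → i ≡ j × bs ≡ cs
  walk-injective {i} {j} bs cs eq
    with mutate-cancel (parent-solution i bs) (parent-solution j cs) (peak-max i bs) (peak-max j cs)
                       (trans (sym (walk-mutate i bs)) (trans eq (walk-mutate j cs)))
    where
    peak-max : ∀ i bs → IsStrictMax (peak i bs) (mutate (peak i bs) (parent i bs))
    peak-max i bs = subst (IsStrictMax (peak i bs)) (walk-mutate i bs) (proj₂ (walk-invariant i bs))
  walk-injective []       []       _ | i≡j , _ = i≡j , refl
  walk-injective []       (_ ∷ cs) _ | _ , one≡walk = ⊥-elim (walk≢one cs (sym one≡walk))
  walk-injective (_ ∷ bs) []       _ | _ , walk≡one = ⊥-elim (walk≢one bs walk≡one)
  walk-injective {i} (b ∷ bs) (c ∷ cs) _ | peaks , walks with walk-injective bs cs walks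
  ... | refl , refl = refl , cong (_∷ bs) (child-injective (peak i bs) peaks)

  peak≢ : ∀ d {t i bs} → Solution t → IsStrictMax d t → walk i bs ≡ mutate d t → peak i bs ≢ d
  peak≢ d {i = i} {bs} s max walk≡ refl =
    mutate-loses-strictMax d s max (subst (IsStrictMax d) walk≡ (proj₂ (walk-invariant i bs)))

  walk-extend : ∀ d {t i bs} → Solution t → IsStrictMax d t → walk i bs ≡ mutate d t →
                ∃ λ b → walk i (b ∷ bs) ≡ t
  walk-extend d {t} {i} {bs} s max walk≡ with child-surjective (peak≢ d {i = i} {bs} s max walk≡)
  ... | b , child≡d = b , (begin
    walk i (b ∷ bs)                          ≡⟨ walk-mutate i (b ∷ bs) ⟩
    mutate (child (peak i bs) b) (walk i bs) ≡⟨ cong₂ mutate child≡d walk≡ ⟩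
    mutate d (mutate d t)                    ≡⟨ mutate-involutive d s ⟩
    t                                        ∎)
    where open ≡-Reasoning

  _⊏_ : Triple → Triple → Set
  s ⊏ t = size s < size t

  reach : ∀ {t} → Acc _⊏_ t → Solution t → t ≡ one ⊎ ∃₂ (λ i bs → walk i bs ≡ t)
  reach {t} (acc smaller) s with maximal t
  ... | d , max with descend d s max
  ...   | inj₁ t≡one = inj₁ t≡one
  ...   | inj₂ (strict , x′<x) with reach (smaller (size-replace d x′<x)) (mutate-solution d s)
  ...     | inj₁ mutate≡one = inj₂ (d , [] , (begin
    rootChild k₁ k₂ k₃ d  ≡⟨ rootChild≡mutate d ⟩
    mutate d one          ≡⟨ cong (mutate d) mutate≡one ⟨
    mutate d (mutate d t) ≡⟨ mutate-involutive d s ⟩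
    t                     ∎))
    where open ≡-Reasoning
  ...     | inj₂ (i , bs , walk≡) =
    let (b , walk≡t) = walk-extend d {i = i} {bs} s strict walk≡ in inj₂ (i , b ∷ bs , walk≡t)

  label-walk : ∀ i bs → label k₁ k₂ k₃ (node i (reverse bs)) ≡ walk i bs
  label-walk i []       = refl
  label-walk i (b ∷ bs) = begin
    foldl st r (reverse (b ∷ bs))  ≡⟨ cong (foldl st r) (unfold-reverse b bs) ⟩
    foldl st r (reverse bs ∷ʳ b)   ≡⟨ foldl-∷ʳ st r b (reverse bs) ⟩
    st (foldl st r (reverse bs)) b ≡⟨ cong (λ t → st t b) (label-walk i bs) ⟩
    st (walk i bs) b               ∎
    where
    open ≡-Reasoning
    st : Triple → Bool → Triple
    st = step k₁ k₂ k₃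
    r : Triple
    r = rootChild k₁ k₂ k₃ i

  label-node : ∀ i bs → label k₁ k₂ k₃ (node i bs) ≡ walk i (reverse bs)
  label-node i bs = trans (cong (λ cs → label k₁ k₂ k₃ (node i cs)) (sym (reverse-involutive bs)))
                          (label-walk i (reverse bs))

  label-injective : ∀ {v w} → label k₁ k₂ k₃ v ≡ label k₁ k₂ k₃ w → v ≡ w
  label-injective {root} {root} _ = refl
  label-injective {root} {node j cs} eq = ⊥-elim (walk≢one (reverse cs) (sym (trans eq (label-node j cs))))
  label-injective {node i bs} {root} eq = ⊥-elim (walk≢one (reverse bs) (trans (sym (label-node i bs)) eq))
  label-injective {node i bs} {node j cs} eq
    with walk-injective (reverse bs) (reverse cs) (trans (sym (label-node i bs)) (trans eq (label-node j cs)))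
  ... | refl , reverse≡ = cong (node i) (reverse-injective reverse≡)

  label-surjective : ∀ {t} → Solution t → ∃ λ v → label k₁ k₂ k₃ v ≡ t
  label-surjective {t} s with reach (On.wellFounded size <-wellFounded t) s
  ... | inj₁ refl = root , refl
  ... | inj₂ (i , bs , refl) = node i (reverse bs) , label-walk i bs

  label-unique : ∀ {t} → Solution t → ∃! _≡_ (λ v → label k₁ k₂ k₃ v ≡ t)
  label-unique s with label-surjective s
  ... | v , refl = v , refl , λ eq → label-injective (sym eq)

module Squares (k : ℕ) where
  open Tree 2 k 2

  TailSquares : Triple → Set
  TailSquares t = IsSquare (t ! Y) × IsSquare (t ! Z)

  mutate-tailSquares : ∀ d {t} → Solution t → TailSquares t → TailSquares (mutate d t)
  mutate-tailSquares X _ squares = squares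
  mutate-tailSquares Y {a , _ , c} s@((_ , 1≤b , _) , _) (□b , □c) =
    isSquare-cancelˡ 1≤b □b (a + c , trans (sym (form-two a c)) (sym (conjugate-product Y s))) , □c
  mutate-tailSquares Z {a , b , _} s@((_ , _ , 1≤c) , _) (□b , □c) =
    □b , isSquare-cancelˡ 1≤c □c (a + b , trans (sym (form-two a b)) (sym (conjugate-product Z s)))

  walk-tailSquares : ∀ i bs → TailSquares (walk i bs)
  walk-tailSquares X [] = (1 , refl) , (1 , refl)
  walk-tailSquares Y [] = (2 , refl) , (1 , refl)
  walk-tailSquares Z [] = (1 , refl) , (2 , refl)
  walk-tailSquares i (b ∷ bs) = subst TailSquares (sym (walk-mutate i (b ∷ bs)))
    (mutate-tailSquares (peak i (b ∷ bs)) (proj₁ (walk-invariant i bs)) (walk-tailSquares i bs))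

  solution-tailSquares : ∀ {t} → Solution t → TailSquares t
  solution-tailSquares s with label-surjective s
  ... | root , refl = (1 , refl) , (1 , refl)
  ... | node i bs , refl = subst TailSquares (sym (label-node i bs)) (walk-tailSquares i (reverse bs))

lemma3p1 : (k A B C : ℕ) → 1 ≤ A → 1 ≤ B → 1 ≤ C → Eqn k A B C →
    ∃! _≡_ (λ (v : Vertex) → label 2 k 2 v ≡ (A , B , C))
    × ∃ (λ b → ∃ (λ c → 1 ≤ b × 1 ≤ c × b * b ≡ B × c * c ≡ C))
lemma3p1 k A B C 1≤A 1≤B 1≤C eqn =
  let ((β , ββ≡B) , (γ , γγ≡C)) = solution-tailSquares solution
  in label-unique solution , β , γ , root-positive ββ≡B 1≤B , root-positive γγ≡C 1≤C , ββ≡B , γγ≡C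
  where
  open Tree 2 k 2
  open Squares k
  solution : Solution (A , B , C)
  solution = (1≤A , 1≤B , 1≤C) , trans eqn constant
    where
    constant : (7 + k) * A * B * C ≡ (3 + 2 + k + 2) * A * B * C
    constant = solve (k ∷ A ∷ B ∷ C ∷ [])
  root-positive : ∀ {r n} → r * r ≡ n → 1 ≤ n → 1 ≤ r
  root-positive {r} rr≡n 1≤n = 1≤m*n⇒1≤n r (subst (1 ≤_) (sym rr≡n) 1≤n)
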